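{- Let $F,F'$ be instances over the same schema such that there is no surjective homomorphism from $F$ onto $F'$ (i.e., no homomorphism $F\to F'$ whose image is all of $\mathrm{adom}(F')$). Then there exists a subinstance $H$ of $F'$ such that $\hom_{\mathbb{N}}(F,H)\neq\hom_{\mathbb{N}}(F',H)$.
   Context: An instance $A$ over a schema assigns to each relation symbol $R$ a finite relation $R^A$ of its arity; $\mathrm{adom}(A)$ is the set of entries of its tuples. A homomorphism $A\to B$ is a map $\mathrm{adom}(A)\to\mathrm{adom}(B)$ mapping tuples of each $R^A$ into $R^B$. $H$ is a subinstance of $F'$ if $R^H\subseteq R^{F'}$ for every relation symbol $R$. $\hom_{\mathbb{N}}(A,B)$ is the number of homomorphisms $A\to B$. -}

module Defs where

open import Data.Nat using (ℕ; zero; suc)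
open import Data.Nat.Properties using (_≟_)
open import Data.Fin using (Fin)
open import Data.Vec as Vec using (Vec)
import Data.Vec.Properties as VecP
open import Data.List using (List; []; _∷_; length; filter; concatMap; map; allFin; zip; deduplicate; concat)
open import Data.List.Relation.Unary.All using (All; all?)
open import Data.Product using (_×_; _,_; Σ; ∃)
open import Relation.Nullary using (Dec; yes; no)
open import Relation.Binary.PropositionalEquality using (_≡_)
import Data.List.Membership.Propositional as MemP
import Data.List.Membership.DecPropositional as DecMem

record Schema : Set where
  field
    size  : ℕ
    arity : Fin size → ℕ
open Schema public

-- An instance over a schema: every relation symbol R is assigned a finite
-- relation, given as a list of tuples (set semantics: only membership matters).
-- Constants are natural numbers.
record Instance (S : Schema) : Set where
  field
    rel : (R : Fin (size S)) → List (Vec ℕ (arity S R))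
open Instance public

module _ {S : Schema} where
  open MemP using (_∈_)

  adom : Instance S → List ℕ
  adom A = deduplicate _≟_
             (concat (map (λ R → concat (map Vec.toList (rel A R))) (allFin (size S))))

  IsHom : (ℕ → ℕ) → Instance S → Instance S → Set
  IsHom f A B = All (λ R → All (λ t → Vec.map f t ∈ rel B R) (rel A R)) (allFin (size S))

  isHom? : (f : ℕ → ℕ) (A B : Instance S) → Dec (IsHom f A B)
  isHom? f A B = all? (λ R → all? (λ t → DecMem._∈?_ (VecP.≡-dec _≟_) (Vec.map f t) (rel B R)) (rel A R)) (allFin (size S))

  SurjHom : Instance S → Instance S → Set
  SurjHom A B = Σ (ℕ → ℕ) λ f → IsHom f A B ×
                  (∀ b → b ∈ adom B → ∃ λ a → a ∈ adom A × f a ≡ b)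

  Subinstance : Instance S → Instance S → Set
  Subinstance H F' = ∀ (R : Fin (size S)) {t} → t ∈ rel H R → t ∈ rel F' R

  assignments : ℕ → List ℕ → List (List ℕ)
  assignments zero    ys = [] ∷ []
  assignments (suc k) ys = concatMap (λ y → map (y ∷_) (assignments k ys)) ys

  -- function from an association list (default 0 outside; irrelevant)
  assocFun : List (ℕ Data.Product.× ℕ) → ℕ → ℕ
  assocFun []             x = 0
  assocFun ((a , b) ∷ ps) x with a ≟ x
  ... | yes _ = b
  ... | no  _ = assocFun ps x

  -- hom_ℕ(A,B): number of maps adom A → adom B that are homomorphisms
  -- (a map is an assignment of an element of adom B to each element of adom A)
  homCount : Instance S → Instance S → ℕ
  homCount A B = length (filter (λ as → isHom? (assocFun (zip (adom A) as)) A B)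
                                (assignments (length (adom A)) (adom B)))

{-# OPTIONS --safe #-}
-- Count homomorphisms by their image. A homomorphism into the subinstance of F' whose
-- tuples avoid a set E of constants is the same as a homomorphism into F' whose image
-- misses E. Writing N(E, C) for the number of homomorphisms into F' whose image misses E
-- and contains C, splitting on whether a constant c is hit gives
-- N(E, C) = N(E, c ∷ C) + N(c ∷ E, C). So if F and F' had the same number of
-- homomorphisms into every such subinstance, induction on C would give them the same
-- N([], adom F'), the number of surjective homomorphisms, which is positive for F'
-- (the identity) and zero for F.

module Submission where

open import Defs
open import Data.Bool.Base using (Bool; true; false; T; _∧_; not; if_then_else_)
open import Data.Bool.Properties using (T-≡; T-∧; ⇔→≡; ∧-zeroʳ; T?)
open import Data.Bool.ListAction using (all)
open import Data.Empty using (⊥-elim)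
open import Data.Fin.Base using (Fin)
open import Data.List.Base using (List; []; _∷_; _++_; length; map; concatMap; filter; zip; allFin)
open import Data.List.Properties using (map-cong)
open import Data.List.Membership.Propositional using (_∈_; _∉_; find; lose)
open import Data.List.Membership.Propositional.Properties
  using ( ∈-filter⁻; ∈-filter⁺; ∈-map⁺; ∈-map⁻; ∈-concatMap⁺; ∈-concatMap⁻; ∈-allFin
        ; ∈-deduplicate⁺; ∈-deduplicate⁻)
open import Data.List.Relation.Binary.BagAndSetEquality using (∼bag⇒↭)
open import Data.List.Membership.Propositional.Properties.WithK using (unique∧set⇒bag)
open import Data.List.Relation.Binary.Permutation.Propositional using (_↭_)
import Data.List.Relation.Binary.Permutation.Propositional.Properties as ↭
open import Data.List.Relation.Binary.Subset.Propositional using (_⊆_)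
open import Data.List.Relation.Binary.Disjoint.Propositional using (Disjoint)
open import Data.List.Relation.Unary.All as All using (All)
open import Data.List.Relation.Unary.AllPairs using (_∷_)
open import Data.List.Relation.Unary.All.Properties using (all⁺; all⁻)
open import Data.List.Relation.Unary.Any as Any using (Any; here; there)
open import Data.List.Relation.Unary.Unique.Propositional using (Unique)
import Data.List.Relation.Unary.Unique.Propositional.Properties as Unique
open import Data.Nat.Base using (ℕ; zero; suc; _+_)
open import Data.Nat.Properties using (_≟_; suc-injective; +-identityʳ; +-assoc; +-cancelʳ-≡; +-commutativeSemigroup)
open import Data.List.Membership.DecPropositional _≟_ using (_∈?_)
open import Data.List.Relation.Unary.Unique.DecPropositional.Properties _≟_ using (deduplicate-!)
open import Data.Nat.ListAction using (sum)
open import Algebra.Properties.CommutativeSemigroup +-commutativeSemigroup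
  renaming (interchange to +-interchange)
  using ()
open import Data.Nat.ListAction.Properties using (sum-↭)
import Data.Vec.Base as Vec
open import Data.Vec.Base using (Vec)
import Data.Vec.Properties as VecP
open import Data.Product using (Σ; ∃; _×_; _,_; proj₁; proj₂)
open import Function.Base using (_∘_; const)
open import Function.Bundles using (_⇔_; mk⇔; Equivalence)
import Function.Properties.Equivalence as ⇔
open import Relation.Nullary using (¬_; yes; no; isYes)
open import Relation.Nullary.Decidable using (toWitness; fromWitness; toWitnessFalse; fromWitnessFalse)
open import Level using (0ℓ)
open import Relation.Unary using (Pred; Decidable)
open import Relation.Binary.PropositionalEquality
  using (_≡_; _≢_; refl; sym; trans; cong; cong₂; subst; module ≡-Reasoning)

toℕ : Bool → ℕ
toℕ false = 0
toℕ true  = 1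

T-injective : ∀ {x y} → T x ⇔ T y → x ≡ y
T-injective x⇔y = ⇔→≡ (⇔.trans (⇔.sym T-≡) (⇔.trans x⇔y T-≡))

private
  variable
    A B : Set

count : (A → Bool) → List A → ℕ
count p []       = 0
count p (x ∷ xs) = toℕ (p x) + count p xs

length-filter≡count : {P : Pred A 0ℓ} (P? : Decidable P) (xs : List A) →
                      length (filter P? xs) ≡ count (isYes ∘ P?) xs
length-filter≡count P? []       = refl
length-filter≡count P? (x ∷ xs) with P? x
... | no _  = length-filter≡count P? xs
... | yes _ = cong suc (length-filter≡count P? xs)

count-cong-∈ : ∀ {p q : A → Bool} (xs : List A) → (∀ {x} → x ∈ xs → p x ≡ q x) → count p xs ≡ count q xs
count-cong-∈ []       p≡q = refl
count-cong-∈ (x ∷ xs) p≡q = cong₂ _+_ (cong toℕ (p≡q (here refl))) (count-cong-∈ xs (p≡q ∘ there))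

count-++ : ∀ (p : A → Bool) xs ys → count p (xs ++ ys) ≡ count p xs + count p ys
count-++ p []       ys = refl
count-++ p (x ∷ xs) ys = trans (cong (toℕ (p x) +_) (count-++ p xs ys)) (sym (+-assoc (toℕ (p x)) _ _))

count-map : ∀ (p : A → Bool) (f : B → A) xs → count p (map f xs) ≡ count (p ∘ f) xs
count-map p f []       = refl
count-map p f (x ∷ xs) = cong (toℕ (p (f x)) +_) (count-map p f xs)

count-concatMap : ∀ (p : A → Bool) (f : B → List A) xs →
                  count p (concatMap f xs) ≡ sum (map (count p ∘ f) xs)
count-concatMap p f []       = refl
count-concatMap p f (x ∷ xs) =
  trans (count-++ p (f x) (concatMap f xs)) (cong (count p (f x) +_) (count-concatMap p f xs))

count-false : ∀ (xs : List A) → count (const false) xs ≡ 0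
count-false []       = refl
count-false (x ∷ xs) = count-false xs

count-+ : ∀ {p q r : A → Bool} (xs : List A) → (∀ x → toℕ (p x) ≡ toℕ (q x) + toℕ (r x)) →
          count p xs ≡ count q xs + count r xs
count-+ [] _ = refl
count-+ {p = p} {q} {r} (x ∷ xs) split = begin
  toℕ (p x) + count p xs                              ≡⟨ cong₂ _+_ (split x) (count-+ xs split) ⟩
  (toℕ (q x) + toℕ (r x)) + (count q xs + count r xs) ≡⟨ +-interchange (toℕ (q x)) (toℕ (r x)) _ _ ⟩
  (toℕ (q x) + count q xs) + (toℕ (r x) + count r xs) ∎
  where open ≡-Reasoning

∈⇒count≢0 : ∀ {p : A → Bool} {x xs} → x ∈ xs → T (p x) → count p xs ≢ 0
∈⇒count≢0 {p = p} {x} (here refl) px rewrite Equivalence.to T-≡ px = λ ()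
∈⇒count≢0 {p = p} {xs = y ∷ xs} (there x∈xs) px with p y
... | true  = λ ()
... | false = ∈⇒count≢0 x∈xs px

count≢0⇒Any : ∀ {p : A → Bool} xs → count p xs ≢ 0 → Any (T ∘ p) xs
count≢0⇒Any         []       c≢0 = ⊥-elim (c≢0 refl)
count≢0⇒Any {p = p} (x ∷ xs) c≢0 with p x in px
... | true  = here (Equivalence.from T-≡ px)
... | false = there (count≢0⇒Any xs c≢0)

sum-map-filter : {P : Pred A 0ℓ} (P? : Decidable P) (f : A → ℕ) (xs : List A) →
                 sum (map f (filter P? xs)) ≡ sum (map (λ x → if isYes (P? x) then f x else 0) xs)
sum-map-filter P? f []       = refl
sum-map-filter P? f (x ∷ xs) with P? x
... | no _  = sum-map-filter P? f xs
... | yes _ = cong (f x +_) (sum-map-filter P? f xs)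

_∈ᵇ_ : ℕ → List ℕ → Bool
x ∈ᵇ xs = isYes (x ∈? xs)

_⊆ᵇ_ : List ℕ → List ℕ → Bool
xs ⊆ᵇ ys = all (_∈ᵇ ys) xs

disjointᵇ : List ℕ → List ℕ → Bool
disjointᵇ xs ys = all (λ x → not (x ∈ᵇ ys)) xs

T-⊆ᵇ : ∀ xs ys → T (xs ⊆ᵇ ys) ⇔ xs ⊆ ys
T-⊆ᵇ xs ys = mk⇔ to from
  where
  to : T (xs ⊆ᵇ ys) → xs ⊆ ys
  to t {x} x∈xs = toWitness {a? = x ∈? ys} (All.lookup (all⁺ _ xs t) x∈xs)
  from : xs ⊆ ys → T (xs ⊆ᵇ ys)
  from xs⊆ys = all⁻ _ (All.tabulate (λ {x} x∈xs → fromWitness {a? = x ∈? ys} (xs⊆ys x∈xs)))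

T-disjointᵇ : ∀ xs ys → T (disjointᵇ xs ys) ⇔ Disjoint xs ys
T-disjointᵇ xs ys = mk⇔ to from
  where
  to : T (disjointᵇ xs ys) → Disjoint xs ys
  to t {x} (x∈xs , x∈ys) = toWitnessFalse {a? = x ∈? ys} (All.lookup (all⁺ _ xs t) x∈xs) x∈ys
  from : Disjoint xs ys → T (disjointᵇ xs ys)
  from disj = all⁻ _ (All.tabulate λ {x} x∈xs →
    fromWitnessFalse {a? = x ∈? ys} (λ x∈ys → disj (x∈xs , x∈ys)))

sum-map-⊆ : ∀ (f : ℕ → ℕ) {X Y} → Unique X → Unique Y → X ⊆ Y →
            sum (map f X) ≡ sum (map (λ y → if y ∈ᵇ X then f y else 0) Y)
sum-map-⊆ f {X} {Y} uX uY X⊆Y = trans (sum-↭ (↭.map⁺ f X↭Y∩X)) (sum-map-filter (_∈? X) f Y)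
  where
  X↭Y∩X : X ↭ filter (_∈? X) Y
  X↭Y∩X = ∼bag⇒↭ (unique∧set⇒bag uX (Unique.filter⁺ (_∈? X) uY)
                   (mk⇔ (λ x∈X → ∈-filter⁺ (_∈? X) (X⊆Y x∈X) x∈X) (proj₂ ∘ ∈-filter⁻ (_∈? X) {xs = Y})))

map-fixed : ∀ {n} (f : ℕ → ℕ) (t : Vec ℕ n) → (∀ {x} → x ∈ Vec.toList t → f x ≡ x) → Vec.map f t ≡ t
map-fixed f Vec.[]       fixes = refl
map-fixed f (x Vec.∷ t) fixes = cong₂ Vec._∷_ (fixes (here refl)) (map-fixed f t (fixes ∘ there))

imageCount : List (List ℕ) → (List ℕ → Bool) → (E C : List ℕ) → ℕ
imageCount L h E C = count (λ as → C ⊆ᵇ as ∧ (disjointᵇ E as ∧ h as)) L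

imageCount-∷ : ∀ L h E c C → imageCount L h E C ≡ imageCount L h E (c ∷ C) + imageCount L h (c ∷ E) C
imageCount-∷ L h E c C = count-+ L (λ as → split (c ∈ᵇ as) (C ⊆ᵇ as) (disjointᵇ E as) (h as))
  where
  split : ∀ hit x y z →
          toℕ (x ∧ (y ∧ z)) ≡ toℕ ((hit ∧ x) ∧ (y ∧ z)) + toℕ (x ∧ ((not hit ∧ y) ∧ z))
  split false x y z = refl
  split true  x y z rewrite ∧-zeroʳ x = sym (+-identityʳ _)

module _ (L₁ : List (List ℕ)) (h₁ : List ℕ → Bool) (L₂ : List (List ℕ)) (h₂ : List ℕ → Bool) where

  imageCount-≢⇒≢[] : ∀ C E → imageCount L₁ h₁ E C ≢ imageCount L₂ h₂ E C →
                 ∃ λ E′ → imageCount L₁ h₁ E′ [] ≢ imageCount L₂ h₂ E′ []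
  imageCount-≢⇒≢[] []      E ≢C = E , ≢C
  imageCount-≢⇒≢[] (c ∷ C) E ≢cC with imageCount L₁ h₁ E C ≟ imageCount L₂ h₂ E C
  ... | no ≢C  = imageCount-≢⇒≢[] C E ≢C
  ... | yes ≡C = imageCount-≢⇒≢[] C (c ∷ E) λ ≡cE → ≢cC (+-cancelʳ-≡ _ _ _ (begin
    imageCount L₁ h₁ E (c ∷ C) + imageCount L₁ h₁ (c ∷ E) C ≡˘⟨ imageCount-∷ L₁ h₁ E c C ⟩
    imageCount L₁ h₁ E C                                    ≡⟨ ≡C ⟩
    imageCount L₂ h₂ E C                                    ≡⟨ imageCount-∷ L₂ h₂ E c C ⟩
    imageCount L₂ h₂ E (c ∷ C) + imageCount L₂ h₂ (c ∷ E) C ≡˘⟨ cong (_ +_) ≡cE ⟩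
    imageCount L₂ h₂ E (c ∷ C) + imageCount L₁ h₁ (c ∷ E) C ∎))
    where open ≡-Reasoning

module _ {S : Schema} where

  ∈-assignments⁻ : ∀ n {as} Y → as ∈ assignments {S} n Y → length as ≡ n × as ⊆ Y
  ∈-assignments⁻ zero    Y (here refl) = refl , λ ()
  ∈-assignments⁻ (suc n) Y as∈
    with y , y∈Y , as∈′ ← find (∈-concatMap⁻ (λ y → map (y ∷_) (assignments {S} n Y)) {xs = Y} as∈)
    with bs , bs∈ , refl ← ∈-map⁻ (y ∷_) as∈′
    with |bs|≡n , bs⊆Y ← ∈-assignments⁻ n Y bs∈
    = cong suc |bs|≡n , λ { (here refl) → y∈Y ; (there x∈bs) → bs⊆Y x∈bs }

  ∈-assignments⁺ : ∀ {as Y} → as ⊆ Y → as ∈ assignments {S} (length as) Y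
  ∈-assignments⁺ {[]}     as⊆Y = here refl
  ∈-assignments⁺ {a ∷ as} as⊆Y =
    ∈-concatMap⁺ _ (lose (as⊆Y (here refl)) (∈-map⁺ (a ∷_) (∈-assignments⁺ (as⊆Y ∘ there))))

  count-assignments-⊆ : ∀ n (q : List ℕ → Bool) {X Y} → Unique X → Unique Y → X ⊆ Y →
                        count q (assignments {S} n X) ≡ count (λ as → as ⊆ᵇ X ∧ q as) (assignments {S} n Y)
  count-assignments-⊆ zero    q uX uY X⊆Y = refl
  count-assignments-⊆ (suc n) q {X} {Y} uX uY X⊆Y = begin
    count q (assignments {S} (suc n) X)
      ≡⟨ count-extend X q ⟩
    sum (map (λ x → count (q ∘ (x ∷_)) (assignments {S} n X)) X)
      ≡⟨ cong sum (map-cong (λ x → count-assignments-⊆ n (q ∘ (x ∷_)) uX uY X⊆Y) X) ⟩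
    sum (map g X)
      ≡⟨ sum-map-⊆ g uX uY X⊆Y ⟩
    sum (map (λ y → if y ∈ᵇ X then g y else 0) Y)
      ≡⟨ cong sum (map-cong guard Y) ⟩
    sum (map (λ y → count (λ as → (y ∷ as) ⊆ᵇ X ∧ q (y ∷ as)) (assignments {S} n Y)) Y)
      ≡˘⟨ count-extend Y _ ⟩
    count (λ as → as ⊆ᵇ X ∧ q as) (assignments {S} (suc n) Y) ∎
    where
    open ≡-Reasoning
    count-extend : ∀ Z p → count p (assignments {S} (suc n) Z) ≡
                           sum (map (λ z → count (p ∘ (z ∷_)) (assignments {S} n Z)) Z)
    count-extend Z p = trans (count-concatMap p _ Z)
                             (cong sum (map-cong (λ z → count-map p (z ∷_) (assignments {S} n Z)) Z))
    g : ℕ → ℕ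
    g x = count (λ as → as ⊆ᵇ X ∧ q (x ∷ as)) (assignments {S} n Y)
    guard : ∀ y → (if y ∈ᵇ X then g y else 0) ≡
                  count (λ as → (y ∷ as) ⊆ᵇ X ∧ q (y ∷ as)) (assignments {S} n Y)
    guard y with y ∈ᵇ X
    ... | true  = refl
    ... | false = sym (count-false (assignments {S} n Y))

  assocFun-here : ∀ a w ps → assocFun {S} ((a , w) ∷ ps) a ≡ w
  assocFun-here a w ps with a ≟ a
  ... | yes _   = refl
  ... | no a≢a = ⊥-elim (a≢a refl)

  assocFun-there : ∀ {a k} w ps → a ≢ k → assocFun {S} ((a , w) ∷ ps) k ≡ assocFun {S} ps k
  assocFun-there {a} {k} w ps a≢k with a ≟ k
  ... | yes a≡k = ⊥-elim (a≢k a≡k)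
  ... | no _    = refl

  assocFun-zip-∈ : ∀ {ks vs : List ℕ} {k} → length ks ≡ length vs → k ∈ ks → assocFun {S} (zip ks vs) k ∈ vs
  assocFun-zip-∈ {a ∷ ks} {v ∷ vs} {k} |ks|≡|vs| k∈ with a ≟ k
  ... | yes _   = here refl
  ... | no a≢k = there (assocFun-zip-∈ (suc-injective |ks|≡|vs|) (Any.tail (a≢k ∘ sym) k∈))

  assocFun-zip-onto : ∀ {ks vs : List ℕ} {v} → Unique ks → length ks ≡ length vs → v ∈ vs →
                      ∃ λ k → k ∈ ks × assocFun {S} (zip ks vs) k ≡ v
  assocFun-zip-onto {a ∷ ks} {w ∷ vs} _ _ (here refl) = a , here refl , assocFun-here a w (zip ks vs)
  assocFun-zip-onto {a ∷ ks} {_ ∷ vs} (a∉ks ∷ uks) |ks|≡|vs| (there v∈vs)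
    with k , k∈ks , k↦v ← assocFun-zip-onto uks (suc-injective |ks|≡|vs|) v∈vs
    = k , there k∈ks , trans (assocFun-there _ (zip ks vs) a≢k) k↦v
    where
    a≢k : a ≢ k
    a≢k refl = All.lookup a∉ks k∈ks refl

  assocFun-zip-diagonal : ∀ {ks : List ℕ} {k} → k ∈ ks → assocFun {S} (zip ks ks) k ≡ k
  assocFun-zip-diagonal {a ∷ ks} {k} k∈ with a ≟ k
  ... | yes a≡k = a≡k
  ... | no a≢k  = assocFun-zip-diagonal (Any.tail (a≢k ∘ sym) k∈)

  ∈-adom⁺ : ∀ (B : Instance S) {R t x} → t ∈ rel B R → x ∈ Vec.toList t → x ∈ adom B
  ∈-adom⁺ B {R} t∈ x∈t =
    ∈-deduplicate⁺ _≟_ (∈-concatMap⁺ _ (lose (∈-allFin R) (∈-concatMap⁺ Vec.toList (lose t∈ x∈t))))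

  ∈-adom⁻ : ∀ (B : Instance S) {x} → x ∈ adom B →
            Σ (Fin (size S)) λ R → Σ (Vec ℕ (arity S R)) λ t → t ∈ rel B R × x ∈ Vec.toList t
  ∈-adom⁻ B x∈
    with R , _ , x∈R ← find (∈-concatMap⁻ _ {xs = allFin (size S)} (∈-deduplicate⁻ _≟_ _ x∈))
    with t , t∈ , x∈t ← find (∈-concatMap⁻ Vec.toList {xs = rel B R} x∈R)
    = R , t , t∈ , x∈t

  adom-mono : ∀ {H B : Instance S} → Subinstance H B → adom H ⊆ adom B
  adom-mono {H} {B} H⊆B x∈ with R , t , t∈ , x∈t ← ∈-adom⁻ H x∈ = ∈-adom⁺ B (H⊆B R t∈) x∈t

  isHom-lookup : ∀ {f} {A B : Instance S} {R t} → IsHom f A B → t ∈ rel A R → Vec.map f t ∈ rel B R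
  isHom-lookup {R = R} hom t∈ = All.lookup (All.lookup hom (∈-allFin R)) t∈

  isHom-tabulate : ∀ {f} {A B : Instance S} →
                   (∀ {R t} → t ∈ rel A R → Vec.map f t ∈ rel B R) → IsHom f A B
  isHom-tabulate maps-tuples = All.tabulate (λ _ → All.tabulate maps-tuples)

  isHom-mono : ∀ {f} {A H B : Instance S} → Subinstance H B → IsHom f A H → IsHom f A B
  isHom-mono H⊆B hom = isHom-tabulate (λ {R} t∈ → H⊆B R (isHom-lookup hom t∈))

  isHom-adom : ∀ {f} {A B : Instance S} {a} → IsHom f A B → a ∈ adom A → f a ∈ adom B
  isHom-adom {f} {A} {B} hom a∈ with R , t , t∈ , a∈t ← ∈-adom⁻ A a∈ =
    ∈-adom⁺ B (isHom-lookup hom t∈) (subst (_ ∈_) (sym (VecP.toList-map f t)) (∈-map⁺ f a∈t))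

  _avoiding_ : Instance S → List ℕ → Instance S
  rel (B avoiding E) R = filter (λ t → T? (disjointᵇ (Vec.toList t) E)) (rel B R)

  avoiding-⊆ : ∀ {B : Instance S} {E} → Subinstance (B avoiding E) B
  avoiding-⊆ R t∈ = proj₁ (∈-filter⁻ _ t∈)

  adom-avoiding : ∀ (B : Instance S) {E x} → x ∈ adom (B avoiding E) → x ∉ E
  adom-avoiding B x∈ x∈E with R , t , t∈ , x∈t ← ∈-adom⁻ (B avoiding _) x∈ =
    Equivalence.to (T-disjointᵇ (Vec.toList t) _) (proj₂ (∈-filter⁻ _ {xs = rel B R} t∈)) (x∈t , x∈E)

  isHom-avoiding : ∀ {f} {A B : Instance S} {E} → IsHom f A B → (∀ {a} → a ∈ adom A → f a ∉ E) →
                   IsHom f A (B avoiding E)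
  isHom-avoiding {f} {A} hom avoids = isHom-tabulate λ {R} {t} t∈ →
    ∈-filter⁺ _ (isHom-lookup hom t∈) (Equivalence.from (T-disjointᵇ _ _) λ (y∈ft , y∈E) →
      let a , a∈t , y≡fa = ∈-map⁻ f (subst (_ ∈_) (VecP.toList-map f t) y∈ft)
      in avoids (∈-adom⁺ A t∈ a∈t) (subst (_∈ _) y≡fa y∈E))

  mapOf : Instance S → List ℕ → ℕ → ℕ
  mapOf A as = assocFun {S} (zip (adom A) as)

  maps : Instance S → List ℕ → List (List ℕ)
  maps A Y = assignments {S} (length (adom A)) Y

  homᵇ : Instance S → Instance S → List ℕ → Bool
  homᵇ A B as = isYes (isHom? (mapOf A as) A B)

  T-homᵇ : ∀ (A B : Instance S) as → T (homᵇ A B as) ⇔ IsHom (mapOf A as) A B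
  T-homᵇ A B as = mk⇔ toWitness fromWitness

  homCount≡count : ∀ (A B : Instance S) → homCount A B ≡ count (homᵇ A B) (maps A (adom B))
  homCount≡count A B = length-filter≡count (λ as → isHom? (mapOf A as) A B) (maps A (adom B))

  homCount-avoiding : ∀ (A B : Instance S) E →
                      homCount A (B avoiding E) ≡ imageCount (maps A (adom B)) (homᵇ A B) E []
  homCount-avoiding A B E = begin
    homCount A H
      ≡⟨ homCount≡count A H ⟩
    count (homᵇ A H) (maps A (adom H))
      ≡⟨ count-assignments-⊆ (length (adom A)) (homᵇ A H) (deduplicate-! _) (deduplicate-! _)
                             (adom-mono (avoiding-⊆ {B} {E})) ⟩
    count (λ as → as ⊆ᵇ adom H ∧ homᵇ A H as) (maps A (adom B))
      ≡⟨ count-cong-∈ (maps A (adom B)) (λ as∈ → pointwise (proj₁ (∈-assignments⁻ _ (adom B) as∈))) ⟩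
    count (λ as → disjointᵇ E as ∧ homᵇ A B as) (maps A (adom B)) ∎
    where
    open ≡-Reasoning
    H = B avoiding E
    pointwise : ∀ {as} → length as ≡ length (adom A) →
                as ⊆ᵇ adom H ∧ homᵇ A H as ≡ disjointᵇ E as ∧ homᵇ A B as
    pointwise {as} |as| = T-injective (⇔.trans T-∧ (⇔.trans (mk⇔ to from) (⇔.sym T-∧)))
      where
      to : T (as ⊆ᵇ adom H) × T (homᵇ A H as) → T (disjointᵇ E as) × T (homᵇ A B as)
      to (as⊆H , homH) =
        Equivalence.from (T-disjointᵇ E as) (λ (x∈E , x∈as) →
          adom-avoiding B (Equivalence.to (T-⊆ᵇ as (adom H)) as⊆H x∈as) x∈E) ,
        Equivalence.from (T-homᵇ A B as) (isHom-mono (avoiding-⊆ {B} {E}) (Equivalence.to (T-homᵇ A H as) homH))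
      from : T (disjointᵇ E as) × T (homᵇ A B as) → T (as ⊆ᵇ adom H) × T (homᵇ A H as)
      from (disj , homB) = Equivalence.from (T-⊆ᵇ as (adom H)) onto , Equivalence.from (T-homᵇ A H as) homH
        where
        homH : IsHom (mapOf A as) A H
        homH = isHom-avoiding (Equivalence.to (T-homᵇ A B as) homB) λ a∈ fa∈E →
          Equivalence.to (T-disjointᵇ E as) disj (fa∈E , assocFun-zip-∈ (sym |as|) a∈)
        onto : as ⊆ adom H
        onto x∈as with a , a∈ , fa≡x ← assocFun-zip-onto (deduplicate-! _) (sym |as|) x∈as =
          subst (_∈ adom H) fa≡x (isHom-adom homH a∈)

  imageCount≢0⇒SurjHom : ∀ (A B : Instance S) →
                         imageCount (maps A (adom B)) (homᵇ A B) [] (adom B) ≢ 0 → SurjHom A B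
  imageCount≢0⇒SurjHom A B count≢0
    with as , as∈ , hit ← find (count≢0⇒Any (maps A (adom B)) count≢0)
    with B⊆as , homB ← Equivalence.to T-∧ hit
    = mapOf A as , Equivalence.to (T-homᵇ A B as) homB , λ b b∈ →
        assocFun-zip-onto (deduplicate-! _) (sym (proj₁ (∈-assignments⁻ _ (adom B) as∈)))
                          (Equivalence.to (T-⊆ᵇ (adom B) as) B⊆as b∈)

  imageCount-self≢0 : ∀ (B : Instance S) → imageCount (maps B (adom B)) (homᵇ B B) [] (adom B) ≢ 0
  imageCount-self≢0 B = ∈⇒count≢0 {x = adom B} (∈-assignments⁺ (λ x∈ → x∈))
    (Equivalence.from T-∧ (Equivalence.from (T-⊆ᵇ (adom B) (adom B)) (λ x∈ → x∈) ,
                           Equivalence.from (T-homᵇ B B (adom B)) identity))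
    where
    identity : IsHom (mapOf B (adom B)) B B
    identity = isHom-tabulate λ {R} {t} t∈ →
      subst (_∈ rel B R) (sym (map-fixed _ t (λ x∈t → assocFun-zip-diagonal (∈-adom⁺ B t∈ x∈t)))) t∈

lemma20 : (S : Schema) (F F' : Instance S) → ¬ SurjHom F F' →
    Σ (Instance S) (λ H → Subinstance H F' × homCount F H ≢ homCount F' H)
lemma20 S F F' ¬surj =
  let E , counts≢ = imageCount-≢⇒≢[] (maps F D) (homᵇ F F') (maps F' D) (homᵇ F' F') D [] surjections≢ in
  F' avoiding E , avoiding-⊆ , λ eq → counts≢ (begin
    imageCount (maps F D) (homᵇ F F') E []   ≡˘⟨ homCount-avoiding F F' E ⟩
    homCount F (F' avoiding E)               ≡⟨ eq ⟩
    homCount F' (F' avoiding E)              ≡⟨ homCount-avoiding F' F' E ⟩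
    imageCount (maps F' D) (homᵇ F' F') E [] ∎)
  where
  open ≡-Reasoning
  D = adom F'
  surjections≢ : imageCount (maps F D) (homᵇ F F') [] D ≢ imageCount (maps F' D) (homᵇ F' F') [] D
  surjections≢ eq = ¬surj (imageCount≢0⇒SurjHom F F' (λ ≡0 → imageCount-self≢0 F' (trans (sym eq) ≡0)))
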